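{- Let a trace monoid $\mathcal{M}=\mathcal{M}(\Sigma,I)$ act partially and irreducibly on a finite set $X_0$. Then the radius of convergence $t_\alpha$ of $Z_\alpha(t)=\sum_{x\in\mathcal{M}_\alpha}t^{|x|}$ does not depend on $\alpha\in X_0$.
   Context: Trace monoid: $\Sigma$ finite, $|\Sigma|\ge2$, $I$ irreflexive symmetric, $\mathcal{M}=\Sigma^*/\langle ab=ba,(a,b)\in I\rangle$, unit $1$, length $|x|$; $a\parallel b$ iff $(a,b)\in I$. A partial action: nonempty $\Sigma(\alpha)\subseteq\Sigma$ for $\alpha\in X_0$ and maps $a\in\Sigma(\alpha)\mapsto\alpha\cdot a\in X_0$ such that if $a\in\Sigma(\alpha)$ and $a\parallel b$, then either $b\in\Sigma(\alpha)$ and $a\in\Sigma(\alpha\cdot b)$, $b\in\Sigma(\alpha\cdot a)$, $(\alpha\cdot a)\cdot b=(\alpha\cdot b)\cdot a$; or $b\notin\Sigma(\alpha)$ and $b\notin\Sigma(\alpha\cdot a)$. The total action is the unique right action on $X_0\cup\{\bot\}$ extending these maps with $\alpha\cdot a=\bot$ for $a\notin\Sigma(\alpha)$, $\bot\cdot a=\bot$. $\mathcal{M}_\alpha=\{x:\alpha\cdot x\ne\bot\}$. A sub-action is a nonempty $Y\subseteq X_0$ with $\alpha\cdot a\in Y$ for all $\alpha\in Y$, $a\in\Sigma(\alpha)$; the action is irreducible if $X_0$ contains no sub-action other than $X_0$ itself. -}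

module Defs where

open import Level using (0ℓ; suc)
open import Data.Nat using (ℕ; zero; suc; _≤_)
open import Data.Fin using (Fin)
open import Data.Maybe using (Maybe; just; nothing)
open import Data.List using (List; []; _∷_; _++_; length; map; foldr; foldl)
open import Data.List.Relation.Unary.All using (All)
open import Data.List.Relation.Unary.AllPairs using (AllPairs)
open import Data.Product using (Σ; ∃; ∃-syntax; _×_; _,_)
open import Data.Sum using (_⊎_)
open import Relation.Nullary using (¬_)
open import Relation.Binary.PropositionalEquality using (_≡_)
open import Relation.Binary using (Rel; Irreflexive; Symmetric)
open import Relation.Unary using (Pred)
open import Data.Rational using (ℚ; 0ℚ; 1ℚ; _*_; _+_) renaming (_≤_ to _≤ℚ_; _<_ to _<ℚ_)

record IndepAlphabet : Set₁ where
  field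
    k      : ℕ
    k≥2    : 2 ≤ k
    I      : Rel (Fin k) 0ℓ
    irrefl : ∀ {a} → ¬ I a a
    sym    : Symmetric I

module _ (A : IndepAlphabet) where
  open IndepAlphabet A

  Word : Set
  Word = List (Fin k)

  -- Trace equivalence: the congruence generated by ab = ba for (a,b) ∈ I.
  -- Elements of the trace monoid M(Σ,I) are the classes of Word under _~_.
  data _~_ : Word → Word → Set where
    ~-refl  : ∀ {u} → u ~ u
    ~-sym   : ∀ {u v} → u ~ v → v ~ u
    ~-trans : ∀ {u v w} → u ~ v → v ~ w → u ~ w
    ~-swap  : ∀ u v {a b} → I a b → (u ++ a ∷ b ∷ v) ~ (u ++ b ∷ a ∷ v)

  -- A partial action of M on a finite set X₀ = Fin m, given by the maps
  -- α ↦ α·a, where step α a ≡ nothing means a ∉ Σ(α)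
  -- and step α a ≡ just (α·a) means a ∈ Σ(α).
  record PartialAction : Set₁ where
    field
      m        : ℕ
      step     : Fin m → Fin k → Maybe (Fin m)
      nonempty : ∀ α → ∃[ a ] ∃[ β ] step α a ≡ just β
      compat   : ∀ α a b β → step α a ≡ just β → I a b →
                 (∃[ γ ] ∃[ δ ] (step α b ≡ just γ × step β b ≡ just δ × step γ a ≡ just δ))
                 ⊎ (step α b ≡ nothing × step β b ≡ nothing)

    -- total action on X₀ ∪ {⊥} (⊥ = nothing), extended to words
    stepT : Maybe (Fin m) → Fin k → Maybe (Fin m)
    stepT nothing  a = nothing
    stepT (just α) a = step α a

    act : Maybe (Fin m) → Word → Maybe (Fin m)
    act = foldl stepT

    -- x ∈ M_α  iff  α·x ≠ ⊥ (stated on representatives)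
    InMα : Fin m → Word → Set
    InMα α w = ∃[ β ] act (just α) w ≡ just β

    IsSubAction : Pred (Fin m) 0ℓ → Set
    IsSubAction Y = (∃[ α ] Y α) × (∀ α a β → Y α → step α a ≡ just β → Y β)

    Irreducible : Set₁
    Irreducible = ∀ (Y : Pred (Fin m) 0ℓ) → IsSubAction Y → ∀ α → Y α

    pow : ℚ → ℕ → ℚ
    pow r zero    = 1ℚ
    pow r (suc n) = r * pow r n

    sumℚ : List ℚ → ℚ
    sumℚ = foldr _+_ 0ℚ

    -- Z_α(r) = Σ_{x ∈ M_α} r^{|x|} converges (for rational r ≥ 0):
    -- the partial sums over finite sets of distinct traces in M_α are bounded.
    -- Distinct traces are represented by pairwise non-equivalent words.
    ConvergesAt : Fin m → ℚ → Set
    ConvergesAt α r = ∃[ B ] ∀ (ws : List Word) →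
      AllPairs (λ u v → ¬ (u ~ v)) ws → All (InMα α) ws →
      sumℚ (map (λ w → pow r (length w)) ws) ≤ℚ B

    -- t_α ≤ t_β, expressed via rationals: whenever Z_α converges at r,
    -- Z_β converges at every rational q with 0 ≤ q < r.
    RadiusLE : Fin m → Fin m → Set
    RadiusLE α β = ∀ (r q : ℚ) → 0ℚ ≤ℚ q → q <ℚ r → ConvergesAt α r → ConvergesAt β q

{-# OPTIONS --safe #-}
-- If α · u = β, then x ↦ u x embeds M_β into M_α, injectively because trace
-- monoids are left cancellative (deleting the first occurrence of a letter
-- respects trace equivalence), and multiplies each weight r^|x| by r^|u|.
-- Hence Z_α(r) ≥ r^|u| Z_β(r), so t_α ≤ t_β; irreducibility makes every state
-- reachable from every other, giving equality.
module Submission where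

open import Defs
open import Data.Product using (_×_; _,_; ∃-syntax)
open import Data.Nat using (zero; suc) renaming (_+_ to _+ℕ_)
open import Data.Fin using (Fin; _≟_)
open import Data.Maybe using (just)
open import Data.List using (List; []; _∷_; _++_; length; map)
open import Data.List.Properties using (foldl-++; length-++)
open import Data.List.Relation.Unary.All as All using (All)
import Data.List.Relation.Unary.All.Properties as All
open import Data.List.Relation.Unary.AllPairs as AllPairs using (AllPairs)
import Data.List.Relation.Unary.AllPairs.Properties as AllPairs
open import Data.Empty using (⊥-elim)
open import Function using (_∘′_)
open import Relation.Nullary using (¬_; Dec; yes; no)
open import Relation.Binary.PropositionalEquality
  using (_≡_; refl; sym; trans; cong; cong₂; subst; subst₂; module ≡-Reasoning)
open import Data.Rational
  using (ℚ; 0ℚ; 1ℚ; _*_; _+_; 1/_; NonZero; Positive; NonNegative; positive; nonNegative)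
  renaming (_≤_ to _≤ℚ_)
import Data.Rational.Properties as ℚ

module LeftCancellation (A : IndepAlphabet) where
  open IndepAlphabet A using (k; I)

  infix 4 _≈_
  _≈_ : Word A → Word A → Set
  _≈_ = _~_ A

  deleteFirst : Fin k → Word A → Word A
  deleteFirst a []      = []
  deleteFirst a (c ∷ w) with c ≟ a
  ... | yes _ = w
  ... | no  _ = c ∷ deleteFirst a w

  deleteFirst-head : ∀ a w → deleteFirst a (a ∷ w) ≡ w
  deleteFirst-head a w with a ≟ a
  ... | yes _   = refl
  ... | no  a≢a = ⊥-elim (a≢a refl)

  deleteFirst-≢ : ∀ {a c} w → ¬ c ≡ a → deleteFirst a (c ∷ w) ≡ c ∷ deleteFirst a w
  deleteFirst-≢ {a} {c} w c≢a with c ≟ a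
  ... | yes c≡a = ⊥-elim (c≢a c≡a)
  ... | no  _   = refl

  ∷-cong : ∀ e {x y} → x ≈ y → e ∷ x ≈ e ∷ y
  ∷-cong e ~-refl         = ~-refl
  ∷-cong e (~-sym p)      = ~-sym (∷-cong e p)
  ∷-cong e (~-trans p q)  = ~-trans (∷-cong e p) (∷-cong e q)
  ∷-cong e (~-swap u v i) = ~-swap (e ∷ u) v i

  deleteFirst-swap : ∀ a u v {c d} → I c d →
                     deleteFirst a (u ++ c ∷ d ∷ v) ≈ deleteFirst a (u ++ d ∷ c ∷ v)
  deleteFirst-swap a [] v {c} {d} i = swapHead (c ≟ a) (d ≟ a)
    where
    swapHead : Dec (c ≡ a) → Dec (d ≡ a) →
               deleteFirst a (c ∷ d ∷ v) ≈ deleteFirst a (d ∷ c ∷ v)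
    swapHead (yes refl) (yes refl) = ~-refl
    swapHead (yes refl) (no d≢a)
      rewrite deleteFirst-head a (d ∷ v) | deleteFirst-≢ (a ∷ v) d≢a
            | deleteFirst-head a v = ~-refl
    swapHead (no c≢a) (yes refl)
      rewrite deleteFirst-head a (c ∷ v) | deleteFirst-≢ (a ∷ v) c≢a
            | deleteFirst-head a v = ~-refl
    swapHead (no c≢a) (no d≢a)
      rewrite deleteFirst-≢ (d ∷ v) c≢a | deleteFirst-≢ v d≢a
            | deleteFirst-≢ (c ∷ v) d≢a | deleteFirst-≢ v c≢a = ~-swap [] (deleteFirst a v) i
  deleteFirst-swap a (e ∷ u) v i with e ≟ a
  ... | yes _ = ~-swap u v i
  ... | no  _ = ∷-cong e (deleteFirst-swap a u v i)

  deleteFirst-cong : ∀ a {x y} → x ≈ y → deleteFirst a x ≈ deleteFirst a y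
  deleteFirst-cong a ~-refl         = ~-refl
  deleteFirst-cong a (~-sym p)      = ~-sym (deleteFirst-cong a p)
  deleteFirst-cong a (~-trans p q)  = ~-trans (deleteFirst-cong a p) (deleteFirst-cong a q)
  deleteFirst-cong a (~-swap u v i) = deleteFirst-swap a u v i

  ∷-cancel : ∀ a {x y} → a ∷ x ≈ a ∷ y → x ≈ y
  ∷-cancel a {x} {y} p =
    subst₂ _≈_ (deleteFirst-head a x) (deleteFirst-head a y) (deleteFirst-cong a p)

  ++-cancelˡ : ∀ u {x y} → u ++ x ≈ u ++ y → x ≈ y
  ++-cancelˡ []      p = p
  ++-cancelˡ (a ∷ u) p = ++-cancelˡ u (∷-cancel a p)

*≤⇒≤1/* : ∀ c .{{_ : Positive c}} {p q} → c * p ≤ℚ q → p ≤ℚ (1/ c) {{ℚ.pos⇒nonZero c}} * q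
*≤⇒≤1/* c {p} {q} cp≤q = ℚ.*-cancelˡ-≤-pos c (subst (c * p ≤ℚ_) (sym c*[1/c*q]≡q) cp≤q)
  where
  open ≡-Reasoning
  instance
    c≢0 : NonZero c
    c≢0 = ℚ.pos⇒nonZero c
  c*[1/c*q]≡q : c * (1/ c * q) ≡ q
  c*[1/c*q]≡q = begin
    c * (1/ c * q)   ≡⟨ sym (ℚ.*-assoc c (1/ c) q) ⟩
    c * (1/ c) * q   ≡⟨ cong (_* q) (ℚ.*-inverseʳ c) ⟩
    1ℚ * q           ≡⟨ ℚ.*-identityˡ q ⟩
    q                ∎

module _ (A : IndepAlphabet) (P : PartialAction A) where
  open PartialAction P
  open LeftCancellation A using (_≈_; ++-cancelˡ)

  act-++ : ∀ x u w → act x (u ++ w) ≡ act (act x u) w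
  act-++ = foldl-++ stepT

  Reachable : Fin m → Fin m → Set
  Reachable α β = ∃[ u ] act (just α) u ≡ just β

  Reachable-isSubAction : ∀ α → IsSubAction (Reachable α)
  Reachable-isSubAction α = (α , [] , refl) , closed
    where
    closed : ∀ γ a δ → Reachable α γ → step γ a ≡ just δ → Reachable α δ
    closed γ a δ (u , α·u≡γ) γ·a≡δ = u ++ a ∷ [] , (begin
      act (just α) (u ++ a ∷ [])  ≡⟨ act-++ (just α) u (a ∷ []) ⟩
      stepT (act (just α) u) a    ≡⟨ cong (λ x → stepT x a) α·u≡γ ⟩
      step γ a                    ≡⟨ γ·a≡δ ⟩
      just δ                      ∎)
      where open ≡-Reasoning

  irreducible⇒reachable : Irreducible → ∀ α β → Reachable α β
  irreducible⇒reachable irr α = irr (Reachable α) (Reachable-isSubAction α)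

  InMα-++ : ∀ α u {β w} → act (just α) u ≡ just β → InMα β w → InMα α (u ++ w)
  InMα-++ α u {w = w} α·u≡β (γ , β·w≡γ) =
    γ , trans (act-++ (just α) u w) (trans (cong (λ x → act x w) α·u≡β) β·w≡γ)

  pow-positive : ∀ r .{{_ : Positive r}} n → Positive (pow r n)
  pow-positive r zero    = _
  pow-positive r (suc n) = ℚ.pos*pos⇒pos r (pow r n) {{pow-positive r n}}

  pow-nonNeg : ∀ r .{{_ : NonNegative r}} n → NonNegative (pow r n)
  pow-nonNeg r zero    = _
  pow-nonNeg r (suc n) = ℚ.nonNeg*nonNeg⇒nonNeg r (pow r n) {{pow-nonNeg r n}}

  pow-mono-≤ : ∀ {q r} → 0ℚ ≤ℚ q → q ≤ℚ r → ∀ n → pow q n ≤ℚ pow r n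
  pow-mono-≤         0≤q q≤r zero    = ℚ.≤-refl
  pow-mono-≤ {q} {r} 0≤q q≤r (suc n) = ℚ.≤-trans
    (ℚ.*-monoʳ-≤-nonNeg (pow q n) {{pow-nonNeg q {{nonNegative 0≤q}} n}} q≤r)
    (ℚ.*-monoˡ-≤-nonNeg r {{nonNegative (ℚ.≤-trans 0≤q q≤r)}} (pow-mono-≤ 0≤q q≤r n))

  pow-+ : ∀ r m n → pow r (m +ℕ n) ≡ pow r m * pow r n
  pow-+ r zero    n = sym (ℚ.*-identityˡ (pow r n))
  pow-+ r (suc m) n = trans (cong (r *_) (pow-+ r m n)) (sym (ℚ.*-assoc r (pow r m) (pow r n)))

  weight : ℚ → Word A → ℚ
  weight r w = pow r (length w)

  partialSum : ℚ → List (Word A) → ℚ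
  partialSum r ws = sumℚ (map (weight r) ws)

  partialSum-mono-≤ : ∀ {q r} → 0ℚ ≤ℚ q → q ≤ℚ r → ∀ ws → partialSum q ws ≤ℚ partialSum r ws
  partialSum-mono-≤ 0≤q q≤r []       = ℚ.≤-refl
  partialSum-mono-≤ 0≤q q≤r (w ∷ ws) =
    ℚ.+-mono-≤ (pow-mono-≤ 0≤q q≤r (length w)) (partialSum-mono-≤ 0≤q q≤r ws)

  partialSum-prefix : ∀ r u ws → partialSum r (map (u ++_) ws) ≡ weight r u * partialSum r ws
  partialSum-prefix r u []       = sym (ℚ.*-zeroʳ (weight r u))
  partialSum-prefix r u (w ∷ ws) = begin
    weight r (u ++ w) + partialSum r (map (u ++_) ws)
      ≡⟨ cong₂ _+_ (trans (cong (pow r) (length-++ u)) (pow-+ r (length u) (length w)))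
                   (partialSum-prefix r u ws) ⟩
    weight r u * weight r w + weight r u * partialSum r ws
      ≡⟨ sym (ℚ.*-distribˡ-+ (weight r u) (weight r w) (partialSum r ws)) ⟩
    weight r u * partialSum r (w ∷ ws)
      ∎
    where open ≡-Reasoning

  ConvergesAt-mono : ∀ {α q r} → 0ℚ ≤ℚ q → q ≤ℚ r → ConvergesAt α r → ConvergesAt α q
  ConvergesAt-mono 0≤q q≤r (B , bounded) = B , λ ws distinct inMα →
    ℚ.≤-trans (partialSum-mono-≤ 0≤q q≤r ws) (bounded ws distinct inMα)

  ConvergesAt-reachable : ∀ {α β} r .{{_ : Positive r}} →
                          Reachable α β → ConvergesAt α r → ConvergesAt β r
  ConvergesAt-reachable {α} {β} r (u , α·u≡β) (B , bounded) =
    (1/ c) {{ℚ.pos⇒nonZero c}} * B , λ ws distinct inMβ →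
      *≤⇒≤1/* c (subst (_≤ℚ B) (partialSum-prefix r u ws)
        (bounded (map (u ++_) ws) (prefix-distinct distinct) (prefix-inMα inMβ)))
    where
    c : ℚ
    c = weight r u
    instance
      c>0 : Positive c
      c>0 = pow-positive r (length u)
    prefix-distinct : ∀ {ws} → AllPairs (λ x y → ¬ x ≈ y) ws →
                      AllPairs (λ x y → ¬ x ≈ y) (map (u ++_) ws)
    prefix-distinct = AllPairs.map⁺ ∘′ AllPairs.map (λ x≉y ux≈uy → x≉y (++-cancelˡ u ux≈uy))
    prefix-inMα : ∀ {ws} → All (InMα β) ws → All (InMα α) (map (u ++_) ws)
    prefix-inMα = All.map⁺ ∘′ All.map (InMα-++ α u α·u≡β)

  Reachable⇒RadiusLE : ∀ {α β} → Reachable α β → RadiusLE α β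
  Reachable⇒RadiusLE α↝β r q 0≤q q<r converges =
    ConvergesAt-mono 0≤q (ℚ.<⇒≤ q<r)
      (ConvergesAt-reachable r {{positive (ℚ.≤-<-trans 0≤q q<r)}} α↝β converges)

corollary2 : (A : IndepAlphabet) (P : PartialAction A) →
    PartialAction.Irreducible P →
    ∀ α β → PartialAction.RadiusLE P α β × PartialAction.RadiusLE P β α
corollary2 A P irr α β =
  Reachable⇒RadiusLE A P (reachable α β) , Reachable⇒RadiusLE A P (reachable β α)
  where
  reachable : ∀ α β → Reachable A P α β
  reachable = irreducible⇒reachable A P irr
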